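{- Let $G$ be a connected graph with $n\ge 3$ vertices, $\mathcal{C}$ a set of $k\ge 2$ colors, $C\colon V(G)\to\mathcal{C}\cup\{\emptyset\}$ a coloring, and let $\mathcal{P}(G,C)\subseteq\mathbb{R}^{\eta k}$ be the polytope defined in the context. Then (i) $\mathcal{P}(G,C)$ is full-dimensional, i.e. $\dim\mathcal{P}(G,C)=\eta k$; and (ii) for every $H\in\mathcal{G}(G)$ and $c\in\mathcal{C}$, the inequality $x_{H,c}\ge 0$ is facet-defining for $\mathcal{P}(G,C)$.
   Context: $\mathcal{G}(G)$ is the collection of all subsets of $V(G)$ that induce connected subgraphs of $G$, and $\eta=|\mathcal{G}(G)|$. Vectors $x\in\mathbb{R}^{\eta k}$ are indexed by pairs $(H,c)$, $H\in\mathcal{G}(G)$, $c\in\mathcal{C}$. $\mathcal{P}(G,C)$ is the convex hull of all $x\in\{0,1\}^{\eta k}$ satisfying $\sum_{H\in\mathcal{G}(G):v\in H}\sum_{c\in\mathcal{C}}x_{H,c}\le 1$ for every $v\in V(G)$ and $\sum_{H\in\mathcal{G}(G)}x_{H,c}\le 1$ for every $c\in\mathcal{C}$. -}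

module Defs where

open import Data.Nat using (ℕ; zero; suc; _+_; _*_; _≤_)
open import Data.Bool using (Bool; true; false)
open import Data.Fin using (Fin)
open import Data.Fin.Subset using (Subset; _∈_)
open import Data.Vec using (lookup)
open import Data.Maybe using (Maybe)
open import Data.Product using (Σ; ∃; _×_; _,_)
open import Data.Rational as ℚ using (ℚ; 0ℚ; 1ℚ)
open import Relation.Nullary using (¬_)
open import Relation.Binary.PropositionalEquality using (_≡_)

record Graph (n : ℕ) : Set₁ where
  field
    Adj     : Fin n → Fin n → Set
    sym     : ∀ {u v} → Adj u v → Adj v u
    irrefl  : ∀ {u} → ¬ Adj u u
open Graph public

-- Reach G S u v : there is a walk from u to v in G all of whose vertices lie in S
-- (the start vertex u is required to lie in S by the callers).
data Reach {n : ℕ} (G : Graph n) (S : Subset n) : Fin n → Fin n → Set where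
  here : ∀ {u} → Reach G S u u
  step : ∀ {u v w} → Adj G u v → v ∈ S → Reach G S v w → Reach G S u w

ConnectedSubset : {n : ℕ} → Graph n → Subset n → Set
ConnectedSubset {n} G S =
  (∃ λ v → v ∈ S) × (∀ u v → u ∈ S → v ∈ S → Reach G S u v)

Connected : {n : ℕ} → Graph n → Set
Connected {n} G = ∀ (u v : Fin n) → Reach G (Data.Vec.replicate n true) u v

∑ : (m : ℕ) → (Fin m → ℕ) → ℕ
∑ zero    f = 0
∑ (suc m) f = f Fin.zero + ∑ m (λ i → f (Fin.suc i))
  where import Data.Fin as Fin

∑ℚ : (m : ℕ) → (Fin m → ℚ) → ℚ
∑ℚ zero    f = 0ℚ
∑ℚ (suc m) f = f Fin.zero ℚ.+ ∑ℚ m (λ i → f (Fin.suc i))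
  where import Data.Fin as Fin

b2ℕ : Bool → ℕ
b2ℕ true  = 1
b2ℕ false = 0

b2ℚ : Bool → ℚ
b2ℚ true  = 1ℚ
b2ℚ false = 0ℚ

-- Points of {0,1}^{η k}: coordinates indexed by (i , c) with i : Fin η standing
-- for the connected subset e i, and c : Fin k a colour.
Point : ℕ → ℕ → Set
Point η k = Fin η → Fin k → Bool

-- The defining system of P(G,C), for an enumeration e : Fin η → Subset n of 𝒢(G).
Feasible : {n η k : ℕ} → (Fin η → Subset n) → Point η k → Set
Feasible {n} {η} {k} e x =
  (∀ (v : Fin n) → ∑ η (λ i → b2ℕ (lookup (e i) v) * ∑ k (λ c → b2ℕ (x i c))) ≤ 1)
  × (∀ (c : Fin k) → ∑ η (λ i → b2ℕ (x i c)) ≤ 1)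

AffinelyIndependent : {η k m : ℕ} → (Fin m → Point η k) → Set
AffinelyIndependent {η} {k} {m} p =
  ∀ (λs : Fin m → ℚ) →
    ∑ℚ m λs ≡ 0ℚ →
    (∀ i c → ∑ℚ m (λ j → λs j ℚ.* b2ℚ (p j i c)) ≡ 0ℚ) →
    ∀ j → λs j ≡ 0ℚ

-- dim P(G,C) = η k : P contains η k + 1 affinely independent points; since P is the
-- convex hull of its feasible 0/1 points, these may be taken among them.
FullDimensional : {n : ℕ} → (η k : ℕ) → (Fin η → Subset n) → Set
FullDimensional η k e =
  Σ (Fin (suc (η * k)) → Point η k) λ p →
    (∀ j → Feasible e (p j)) × AffinelyIndependent p

-- x_{e i, c} ≥ 0 is facet-defining for the full-dimensional polytope P(G,C):
-- it is valid (automatic for 0/1 points) and the face {x ∈ P : x_{e i,c} = 0}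
-- has dimension η k - 1, i.e. contains η k affinely independent points
-- (again taken among the feasible 0/1 points, which span the face).
FacetDefiningNonneg : {n : ℕ} → (η k : ℕ) → (Fin η → Subset n) → Fin η → Fin k → Set
FacetDefiningNonneg η k e i c =
  Σ (Fin (η * k) → Point η k) λ p →
    (∀ j → Feasible e (p j)) × (∀ j → p j i c ≡ false) × AffinelyIndependent p

-- The origin and the η k unit vectors of ℚ^{η k} are 0/1 points with at most one
-- nonzero coordinate, so they satisfy every vertex and every colour constraint; they
-- are affinely independent, hence P(G,C) is full-dimensional. Replacing the unit
-- vector e_{H,c} by the origin leaves η k affinely independent feasible points on the
-- face x_{H,c} = 0, which is therefore a facet. Neither the graph, nor the colouring,
-- nor the bounds n ≥ 3 and k ≥ 2 play any role.

{-# OPTIONS --safe #-}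
module Submission where

open import Defs hiding (sym)
open import Algebra.Bundles using (CommutativeMonoid)
import Algebra.Properties.CommutativeMonoid.Sum as CommutativeMonoidSum
open import Data.Bool using (true; false)
open import Data.Fin using (Fin; remQuot) renaming (zero to fzero; suc to fsuc)
open import Data.Fin.Properties using (punchInᵢ≢i; *↔×) renaming (_≟_ to _≟ᶠ_)
open import Data.Fin.Subset using (Subset)
open import Data.Maybe using (Maybe; just; nothing)
open import Data.Maybe.Properties using (just-injective) renaming (≡-dec to ≡-decᴹ)
open import Data.Nat using (ℕ; zero; suc; _+_; _*_; _≤_; z≤n)
import Data.Nat.Properties as ℕ
open import Data.Product using (∃; _×_; _,_)
open import Data.Product.Properties using (,-injectiveˡ; ,-injectiveʳ) renaming (≡-dec to ≡-dec×)
open import Data.Rational as ℚ using (ℚ; 0ℚ)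
import Data.Rational.Properties as ℚ
open import Data.Vec using (lookup)
open import Data.Vec.Functional using (Vector; removeAt; replicate; _∷_)
open import Function using (_∘_)
open import Function.Bundles using (_⇔_; Injection)
open import Function.Definitions using (Injective)
open import Function.Properties.Inverse using (↔⇒↣)
open import Relation.Binary.Definitions using (DecidableEquality)
open import Relation.Binary.PropositionalEquality
  using (_≡_; _≢_; refl; sym; trans; cong; module ≡-Reasoning)
open import Relation.Nullary using (does; yes; no; contradiction)
open import Relation.Nullary.Decidable using (dec-true; dec-false)

module _ {a ℓ} (M : CommutativeMonoid a ℓ) where
  open CommutativeMonoid M using (Carrier; _≈_; _∙_; ε; ∙-congˡ; identityʳ; setoid)
  open CommutativeMonoidSum M using (sum; sum-cong-≋; sum-replicate-zero; sum-remove)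
  open import Relation.Binary.Reasoning.Setoid setoid

  sum-zero : ∀ {m} (t : Vector Carrier m) → (∀ j → t j ≈ ε) → sum t ≈ ε
  sum-zero {m} t t≈ε = begin
    sum t               ≈⟨ sum-cong-≋ t≈ε ⟩
    sum (replicate m ε) ≈⟨ sum-replicate-zero m ⟩
    ε                   ∎

  sum-single : ∀ {m} (t : Vector Carrier m) i → (∀ j → j ≢ i → t j ≈ ε) → sum t ≈ t i
  sum-single {suc m} t i t≈ε = begin
    sum t                    ≈⟨ sum-remove t ⟩
    t i ∙ sum (removeAt t i) ≈⟨ ∙-congˡ (sum-zero (removeAt t i) (λ j → t≈ε _ (punchInᵢ≢i i j))) ⟩
    t i ∙ ε                  ≈⟨ identityʳ (t i) ⟩
    t i                      ∎

module ℕ-Sum = CommutativeMonoidSum ℕ.+-0-commutativeMonoid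
module ℚ-Sum = CommutativeMonoidSum ℚ.+-0-commutativeMonoid

∑≡sum : ∀ {m} (f : Fin m → ℕ) → ∑ m f ≡ ℕ-Sum.sum f
∑≡sum {zero}  f = refl
∑≡sum {suc m} f = cong (f fzero +_) (∑≡sum (f ∘ fsuc))

∑ℚ≡sum : ∀ {m} (f : Fin m → ℚ) → ∑ℚ m f ≡ ℚ-Sum.sum f
∑ℚ≡sum {zero}  f = refl
∑ℚ≡sum {suc m} f = cong (f fzero ℚ.+_) (∑ℚ≡sum (f ∘ fsuc))

∑-zero : ∀ {m} (f : Fin m → ℕ) → (∀ j → f j ≡ 0) → ∑ m f ≡ 0
∑-zero f f≡0 = trans (∑≡sum f) (sum-zero ℕ.+-0-commutativeMonoid f f≡0)

∑-single : ∀ {m} (f : Fin m → ℕ) i → (∀ j → j ≢ i → f j ≡ 0) → ∑ m f ≡ f i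
∑-single f i f≡0 = trans (∑≡sum f) (sum-single ℕ.+-0-commutativeMonoid f i f≡0)

∑ℚ-single : ∀ {m} (f : Fin m → ℚ) i → (∀ j → j ≢ i → f j ≡ 0ℚ) → ∑ℚ m f ≡ f i
∑ℚ-single f i f≡0 = trans (∑ℚ≡sum f) (sum-single ℚ.+-0-commutativeMonoid f i f≡0)

∑-mono-≤ : ∀ {m} {f g : Fin m → ℕ} → (∀ j → f j ≤ g j) → ∑ m f ≤ ∑ m g
∑-mono-≤ {zero}  f≤g = z≤n
∑-mono-≤ {suc m} f≤g = ℕ.+-mono-≤ (f≤g fzero) (∑-mono-≤ (f≤g ∘ fsuc))

≤-∑ : ∀ {m} (f : Fin m → ℕ) j → f j ≤ ∑ m f
≤-∑ f fzero    = ℕ.m≤m+n _ _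
≤-∑ f (fsuc j) = ℕ.≤-trans (≤-∑ (f ∘ fsuc) j) (ℕ.m≤n+m _ _)

b2ℕ*n≤n : ∀ b n → b2ℕ b * n ≤ n
b2ℕ*n≤n true  n = ℕ.≤-reflexive (ℕ.+-identityʳ n)
b2ℕ*n≤n false n = z≤n

module _ {η k : ℕ} where

  weight : Point η k → ℕ
  weight x = ∑ η (λ i → ∑ k (λ c → b2ℕ (x i c)))

  weight≤1⇒feasible : ∀ {n} (e : Fin η → Subset n) x → weight x ≤ 1 → Feasible e x
  weight≤1⇒feasible e x w≤1 = vertex , colour
    where
    vertex : ∀ v → ∑ η (λ i → b2ℕ (lookup (e i) v) * ∑ k (λ c → b2ℕ (x i c))) ≤ 1
    vertex v = ℕ.≤-trans (∑-mono-≤ {η} (λ i → b2ℕ*n≤n (lookup (e i) v) _)) w≤1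
    colour : ∀ c → ∑ η (λ i → b2ℕ (x i c)) ≤ 1
    colour c = ℕ.≤-trans (∑-mono-≤ {η} (λ i → ≤-∑ (λ c → b2ℕ (x i c)) c)) w≤1

  _≟ᶜ_ : DecidableEquality (Fin η × Fin k)
  _≟ᶜ_ = ≡-dec× _≟ᶠ_ _≟ᶠ_

  _≟ᴹ_ : DecidableEquality (Maybe (Fin η × Fin k))
  _≟ᴹ_ = ≡-decᴹ _≟ᶜ_

  indicator : Maybe (Fin η × Fin k) → Point η k
  indicator s i c = does (s ≟ᴹ just (i , c))

  indicator-self : ∀ i c → indicator (just (i , c)) i c ≡ true
  indicator-self i c = dec-true (just (i , c) ≟ᴹ just (i , c)) refl

  indicator-else : ∀ s i c → s ≢ just (i , c) → indicator s i c ≡ false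
  indicator-else s i c = dec-false (s ≟ᴹ just (i , c))

  weight-indicator : ∀ s → weight (indicator s) ≤ 1
  weight-indicator nothing =
    ℕ.≤-trans (ℕ.≤-reflexive (∑-zero {η} _ (λ i → ∑-zero {k} _ (λ c → refl)))) z≤n
  weight-indicator (just (i₀ , c₀)) = begin
    weight (indicator a) ≡⟨ ∑-single row i₀ off-row ⟩
    row i₀               ≡⟨ ∑-single (entry i₀) c₀ off-column ⟩
    entry i₀ c₀          ≡⟨ cong b2ℕ (indicator-self i₀ c₀) ⟩
    1                    ∎
    where
    open ℕ.≤-Reasoning
    a = just (i₀ , c₀)
    entry : Fin η → Fin k → ℕ
    entry i c = b2ℕ (indicator a i c)
    row : Fin η → ℕ
    row i = ∑ k (entry i)
    off-column : ∀ c → c ≢ c₀ → entry i₀ c ≡ 0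
    off-column c c≢c₀ = cong b2ℕ (indicator-else a i₀ c (c≢c₀ ∘ sym ∘ ,-injectiveʳ ∘ just-injective))
    off-row : ∀ i → i ≢ i₀ → row i ≡ 0
    off-row i i≢i₀ = ∑-zero (entry i) (λ c →
      cong b2ℕ (indicator-else a i c (i≢i₀ ∘ sym ∘ ,-injectiveˡ ∘ just-injective)))

  feasible-indicator : ∀ {n} (e : Fin η → Subset n) s → Feasible e (indicator s)
  feasible-indicator e s = weight≤1⇒feasible e (indicator s) (weight-indicator s)

  indicators-affinelyIndependent : ∀ {m} (σ : Fin m → Maybe (Fin η × Fin k)) →
    Injective _≡_ _≡_ σ → AffinelyIndependent (indicator ∘ σ)
  indicators-affinelyIndependent {m} σ σ-injective λs ∑λ≡0 ∑λx≡0 = vanish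
    where
    open ≡-Reasoning
    term : Fin η → Fin k → Fin m → ℚ
    term i c j = λs j ℚ.* b2ℚ (indicator (σ j) i c)

    vanish-at-unit : ∀ j {i c} → σ j ≡ just (i , c) → λs j ≡ 0ℚ
    vanish-at-unit j {i} {c} σj≡ = begin
      λs j              ≡⟨ ℚ.*-identityʳ (λs j) ⟨
      λs j ℚ.* b2ℚ true ≡⟨ cong (λ b → λs j ℚ.* b2ℚ b) at-j ⟨
      term i c j        ≡⟨ ∑ℚ-single (term i c) j off-j ⟨
      ∑ℚ m (term i c)   ≡⟨ ∑λx≡0 i c ⟩
      0ℚ                ∎
      where
      at-j : indicator (σ j) i c ≡ true
      at-j = trans (cong (λ s → indicator s i c) σj≡) (indicator-self i c)
      off-j : ∀ j′ → j′ ≢ j → term i c j′ ≡ 0ℚ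
      off-j j′ j′≢j = begin
        term i c j′        ≡⟨ cong (λ b → λs j′ ℚ.* b2ℚ b) (indicator-else (σ j′) i c σj′≢σj) ⟩
        λs j′ ℚ.* 0ℚ       ≡⟨ ℚ.*-zeroʳ (λs j′) ⟩
        0ℚ                 ∎
        where
        σj′≢σj : σ j′ ≢ just (i , c)
        σj′≢σj σj′≡ = j′≢j (σ-injective (trans σj′≡ (sym σj≡)))

    vanish : ∀ j → λs j ≡ 0ℚ
    vanish j with σ j in σj≡
    ... | just (i , c) = vanish-at-unit j σj≡
    ... | nothing      = trans (sym (∑ℚ-single λs j others)) ∑λ≡0
      where
      others : ∀ j′ → j′ ≢ j → λs j′ ≡ 0ℚ
      others j′ j′≢j with σ j′ in σj′≡
      ... | just (i , c) = vanish-at-unit j′ σj′≡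
      ... | nothing      = contradiction (σ-injective (trans σj′≡ (sym σj≡))) j′≢j

nothing∷just-injective : ∀ {A : Set} {m} {f : Fin m → A} →
  Injective _≡_ _≡_ f → Injective _≡_ _≡_ (nothing ∷ just ∘ f)
nothing∷just-injective f-injective {fzero}  {fzero}  _  = refl
nothing∷just-injective f-injective {fsuc i} {fsuc j} eq = cong fsuc (f-injective (just-injective eq))

module _ {A : Set} (_≟_ : DecidableEquality A) where

  except : A → A → Maybe A
  except a b with b ≟ a
  ... | yes _ = nothing
  ... | no _  = just b

  except-≢-just : ∀ a b → except a b ≢ just a
  except-≢-just a b with b ≟ a
  ... | yes _   = λ ()
  ... | no b≢a  = b≢a ∘ just-injective

  except-injective : ∀ a → Injective _≡_ _≡_ (except a)
  except-injective a {b} {b′} eq with b ≟ a | b′ ≟ a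
  ... | yes b≡a | yes b′≡a = trans b≡a (sym b′≡a)
  ... | no _    | no _     = just-injective eq

proposition2 : (n k : ℕ) → 3 ≤ n → 2 ≤ k →
    (G : Graph n) → Connected G →
    (C : Fin n → Maybe (Fin k)) →
    (η : ℕ) (e : Fin η → Subset n) → Injective _≡_ _≡_ e →
    (∀ (S : Subset n) → ConnectedSubset G S ⇔ (∃ λ i → e i ≡ S)) →
    FullDimensional η k e × (∀ (i : Fin η) (c : Fin k) → FacetDefiningNonneg η k e i c)
proposition2 n k _ _ _ _ _ η e _ _ = fullDimensional , facet
  where
  coordinate : Fin (η * k) → Fin η × Fin k
  coordinate = remQuot k

  coordinate-injective : Injective _≡_ _≡_ coordinate
  coordinate-injective = Injection.injective (↔⇒↣ *↔×)

  fullDimensional : FullDimensional η k e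
  fullDimensional =
    indicator ∘ σ , feasible-indicator e ∘ σ ,
    indicators-affinelyIndependent σ (nothing∷just-injective coordinate-injective)
    where
    σ : Fin (suc (η * k)) → Maybe (Fin η × Fin k)
    σ = nothing ∷ just ∘ coordinate

  facet : ∀ i c → FacetDefiningNonneg η k e i c
  facet i c =
    indicator ∘ τ , feasible-indicator e ∘ τ ,
    (λ j → indicator-else (τ j) i c (except-≢-just _≟ᶜ_ (i , c) (coordinate j))) ,
    indicators-affinelyIndependent τ (coordinate-injective ∘ except-injective _≟ᶜ_ (i , c))
    where
    -- τ sends the index of (i , c) to nothing, so it carries the origin instead of e_{i,c}.
    τ : Fin (η * k) → Maybe (Fin η × Fin k)
    τ = except _≟ᶜ_ (i , c) ∘ coordinate
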